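{- Let $(G,R)$ be a finite rooted graph without sinks. If the unfolding tree $\mathcal{T}(G,R)$ is cocompact, then $t^{ -1}(R)=\emptyset$, i.e. no edge of $G$ terminates at $R$.
   Context: Graphs are directed multigraphs $G=(VG,EG,o,t)$; a sink is a vertex with no outgoing edges. A path is an empty path $\varepsilon_v$ or a sequence $e_1\cdots e_n$ of edges with $t(e_i)=o(e_{i+1})$; $O,T$ give origin and terminus. A rooted graph $(G,R)$ has every vertex reachable from $R$. The unfolding tree $\mathcal{T}(G,R)$ has vertices the paths $p$ with $O(p)=R$ and an edge $(p,pe)$ from $p$ to $pe$ for each edge $e$ with $o(e)=T(p)$; it is a rooted tree with root $\varepsilon_R$. For a rooted tree $\mathcal{T}$ with root $R$ and vertex $v$, $\mathcal{T}^v$ has the same vertices and edges with the edges on the path from $R$ to $v$ reversed. $\cong$ is isomorphism of directed graphs. A rooted tree is cocompact if there are a finite set $F$ and $l:V\mathcal{T}\to F$ with $l(v)=l(w)\Rightarrow\mathcal{T}^v\cong\mathcal{T}^w$. -}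

module Defs where

open import Data.Nat using (ℕ)
open import Data.Fin using (Fin)
open import Data.Fin.Properties using (_≟_)
open import Data.List using (List; []; _∷_; _++_; [_])
open import Data.Product using (Σ; Σ-syntax; ∃; ∃-syntax; _×_; _,_; proj₁; proj₂)
open import Data.Unit using (⊤; tt)
open import Data.Bool using (Bool; true; false; if_then_else_; _∧_)
open import Relation.Nullary using (¬_; does)
open import Relation.Binary.PropositionalEquality using (_≡_; refl)
open import Function.Bundles using (_↔_; Inverse)

record DiGraph : Set₁ where
  field
    V   : Set
    E   : Set
    src : E → V
    tgt : E → V

open DiGraph public

record _≅_ (G H : DiGraph) : Set where
  field
    φV     : V G ↔ V H
    φE     : E G ↔ E H
    φ-src  : ∀ e → src H (Inverse.to φE e) ≡ Inverse.to φV (src G e)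
    φ-tgt  : ∀ e → tgt H (Inverse.to φE e) ≡ Inverse.to φV (tgt G e)

record FinGraph : Set where
  field
    n : ℕ
    m : ℕ
    o : Fin m → Fin n
    t : Fin m → Fin n

module _ (G : FinGraph) where
  open FinGraph G

  Vtx : Set
  Vtx = Fin n

  Edg : Set
  Edg = Fin m

  IsSink : Vtx → Set
  IsSink v = ¬ (Σ[ e ∈ Edg ] o e ≡ v)

  NoSinks : Set
  NoSinks = ∀ v → ¬ IsSink v

  IsPathFrom : Vtx → List Edg → Set
  IsPathFrom v []       = ⊤
  IsPathFrom v (e ∷ es) = (o e ≡ v) × IsPathFrom (t e) es

  terminus : Vtx → List Edg → Vtx
  terminus v []       = v
  terminus v (e ∷ es) = terminus (t e) es

  IsRooted : Vtx → Set
  IsRooted R = ∀ v → Σ[ p ∈ List Edg ] (IsPathFrom R p × terminus R p ≡ v)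

  snoc-path : ∀ v (p : List Edg) (e : Edg) → IsPathFrom v p →
              o e ≡ terminus v p → IsPathFrom v (p ++ [ e ])
  snoc-path v []       e _ oe = oe , tt
  snoc-path v (x ∷ p) e (ox , hp) oe = ox , snoc-path (t x) p e hp oe

  isPrefix : List Edg → List Edg → Bool
  isPrefix []       _        = true
  isPrefix (x ∷ xs) []       = false
  isPrefix (x ∷ xs) (y ∷ ys) = does (x ≟ y) ∧ isPrefix xs ys

  module _ (R : Vtx) where
    UVertex : Set
    UVertex = Σ[ p ∈ List Edg ] IsPathFrom R p

    -- edges of the unfolding tree: one edge (p , pe) for each e with o(e) = T(p)
    UEdge : Set
    UEdge = Σ[ p ∈ UVertex ] Σ[ e ∈ Edg ] (o e ≡ terminus R (proj₁ p))

    uSrc : UEdge → UVertex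
    uSrc (p , _ , _) = p

    uTgt : UEdge → UVertex
    uTgt ((p , hp) , e , oe) = (p ++ [ e ]) , snoc-path R p e hp oe

    Unfolding : DiGraph
    Unfolding = record { V = UVertex ; E = UEdge ; src = uSrc ; tgt = uTgt }

    uRoot : UVertex
    uRoot = [] , tt

    -- an edge (p , pe) lies on the (unique) path from the root to q
    -- iff pe is a prefix of q
    onPathTo : UVertex → UEdge → Bool
    onPathTo q ε = isPrefix (proj₁ (uTgt ε)) (proj₁ q)

    UnfoldingAt : UVertex → DiGraph
    UnfoldingAt q = record
      { V = UVertex
      ; E = UEdge
      ; src = λ ε → if onPathTo q ε then uTgt ε else uSrc ε
      ; tgt = λ ε → if onPathTo q ε then uSrc ε else uTgt ε
      }

    -- 𝒯(G , R) is cocompact: a finite set F (= Fin k) and a labelling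
    -- l : V𝒯 → F with l v ≡ l w ⇒ 𝒯^v ≅ 𝒯^w
    IsCocompactUnfolding : Set
    IsCocompactUnfolding =
      Σ[ k ∈ ℕ ] Σ[ l ∈ (UVertex → Fin k) ]
        (∀ v w → l v ≡ l w → UnfoldingAt v ≅ UnfoldingAt w)

-- An edge e into R closes a cycle c at R, giving the vertices c⁰, c¹, c², …
-- of the unfolding tree, and cocompactness gives i < j with 𝒯^(cⁱ) ≅ 𝒯^(cʲ).
-- Prefixing paths by P = cʲ⁻ⁱ embeds 𝒯^(cⁱ) into 𝒯^(cʲ) without hitting the
-- root; followed by the inverse isomorphism this is an injective self-map ψ of
-- 𝒯^(cⁱ).  Since cⁱ is the only vertex of 𝒯^(cⁱ) without incoming edges, ψ
-- fixes it, so ψ maps the ball of radius |cʲ| around cⁱ into itself; this ball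
-- is finite because G is, and it contains the image of the root, which ψ
-- misses.  An injective self-map of a finite set cannot miss a point.
module Submission where

open import Defs
open import Axiom.UniquenessOfIdentityProofs using (module Decidable⇒UIP)
open import Data.Bool using (Bool; true; false; if_then_else_)
open import Data.Empty using (⊥-elim)
open import Data.Fin using (Fin; toℕ)
open import Data.Fin.Properties using (pigeonhole) renaming (_≟_ to _≟ᶠ_)
open import Data.List using (List; []; _∷_; _++_; [_]; length; allFin; cartesianProductWith; initLast; _∷ʳ′_)
open import Data.List.Membership.Propositional using (_∈_)
open import Data.List.Membership.Propositional.Properties using (∈-allFin; ∈-cartesianProductWith⁺)
open import Data.List.Membership.Setoid.Properties using (index-injective)
open import Data.List.Properties using (++-assoc; length-++; ++-identityʳ; ++-identityʳ-unique; ++-cancelˡ; ++-conicalˡ; ++-conicalʳ; ≡-dec)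
open import Data.List.Relation.Unary.Any using (here; there; index)
open import Data.Nat using (ℕ; zero; suc; _+_; _∸_; _≤_; s≤s)
open import Data.Nat.Properties using (≤-trans; n≤1+n; ≤-reflexive; m≤n⇒m≤1+n; n<1+n; <⇒≢; +-suc; +-identityʳ; +-comm; m∸n+n≡m)
open import Data.Product using (∃-syntax; _×_; _,_; proj₁; proj₂; map₂)
open import Data.Unit using (tt)
open import Function using (Injective; Injection; _∘_)
open import Function.Bundles using (Inverse)
open import Function.Construct.Symmetry using (↔-sym)
open import Function.Properties.Inverse using (↔⇒↣)
open import Relation.Nullary using (¬_; yes; no; contradiction)
open import Relation.Nullary.Decidable using (dec-true)
open import Relation.Binary.PropositionalEquality using (_≡_; _≢_; refl; sym; trans; cong; cong₂; subst; setoid)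

if-true : ∀ {A : Set} {b : Bool} {x y : A} → b ≡ true → (if b then x else y) ≡ x
if-true refl = refl

if-false : ∀ {A : Set} {b : Bool} {x y : A} → b ≡ false → (if b then x else y) ≡ y
if-false refl = refl

record Hom (X Y : DiGraph) : Set where
  field
    onV      : V X → V Y
    onE      : E X → E Y
    src-comm : ∀ e → src Y (onE e) ≡ onV (src X e)
    tgt-comm : ∀ e → tgt Y (onE e) ≡ onV (tgt X e)

_∘ᴴ_ : ∀ {X Y Z} → Hom Y Z → Hom X Y → Hom X Z
g ∘ᴴ f = record
  { onV      = onV g ∘ onV f
  ; onE      = onE g ∘ onE f
  ; src-comm = λ e → trans (src-comm g (onE f e)) (cong (onV g) (src-comm f e))
  ; tgt-comm = λ e → trans (tgt-comm g (onE f e)) (cong (onV g) (tgt-comm f e))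
  }
  where open Hom

data Walk (X : DiGraph) (a : V X) : V X → ℕ → Set where
  stop : Walk X a a 0
  step : ∀ {b c k} → Walk X a b k → (e : E X) → src X e ≡ b → tgt X e ≡ c →
         Walk X a c (suc k)

map-walk : ∀ {X Y} (h : Hom X Y) {a b k} → Walk X a b k →
           Walk Y (Hom.onV h a) (Hom.onV h b) k
map-walk h stop = stop
map-walk h (step w e src≡ tgt≡) =
  step (map-walk h w) (onE e) (trans (src-comm e) (cong onV src≡))
       (trans (tgt-comm e) (cong onV tgt≡))
  where open Hom h

IsSource : (X : DiGraph) → V X → Set
IsSource X v = ∀ e → tgt X e ≢ v

module _ {X Y : DiGraph} (φ : X ≅ Y) where
  open _≅_ φ
  private
    fromV = Inverse.from φV
    fromE = Inverse.from φE

  from-hom : Hom Y X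
  from-hom = record
    { onV      = fromV
    ; onE      = fromE
    ; src-comm = λ e → from-comm src φ-src e
    ; tgt-comm = λ e → from-comm tgt φ-tgt e
    }
    where
      from-comm : (end : ∀ D → E D → V D) →
                  (∀ e → end Y (Inverse.to φE e) ≡ Inverse.to φV (end X e)) →
                  ∀ e → end X (fromE e) ≡ fromV (end Y e)
      from-comm end comm e =
        trans (sym (Inverse.strictlyInverseʳ φV _))
              (cong fromV (trans (sym (comm (fromE e))) (cong (end Y) (Inverse.strictlyInverseˡ φE e))))

  from-injective : Injective _≡_ _≡_ fromV
  from-injective = Injection.injective (↔⇒↣ (↔-sym φV))

  from-isSource : ∀ {w} → IsSource Y w → IsSource X (fromV w)
  from-isSource {w} w-source e tgt≡ = w-source (Inverse.to φE e)
    (trans (φ-tgt e) (trans (cong (Inverse.to φV) tgt≡) (Inverse.strictlyInverseˡ φV w)))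

shortLists : (m K : ℕ) → List (List (Fin m))
shortLists m zero    = [ [] ]
shortLists m (suc K) = [] ∷ cartesianProductWith _∷_ (allFin m) (shortLists m K)

∈-shortLists : ∀ {m K} (xs : List (Fin m)) → length xs ≤ K → xs ∈ shortLists m K
∈-shortLists {K = zero}  []       _         = here refl
∈-shortLists {K = suc K} []       _         = here refl
∈-shortLists             (x ∷ xs) (s≤s |xs|≤K) =
  there (∈-cartesianProductWith⁺ _∷_ (∈-allFin x) (∈-shortLists xs |xs|≤K))

module _ {A B : Set} (f : A → A) (f-injective : Injective _≡_ _≡_ f)
         (S : A → Set) (f-preserves-S : ∀ {a} → S a → S (f a))
         (code : A → B) (code-injective : Injective _≡_ _≡_ code)
         (xs : List B) (S⇒code∈xs : ∀ {a} → S a → code a ∈ xs) where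

  injective-endo-misses-nothing : ∀ {x} → S x → ¬ (∀ y → f y ≢ x)
  injective-endo-misses-nothing {x} x∈S x-missed =
    let i , j , i<j , same-index = pigeonhole (n<1+n (length xs)) (index ∘ orbit-code ∘ toℕ)
    in <⇒≢ i<j (orbit-injective (toℕ i) (toℕ j)
         (code-injective (index-injective (setoid B) (orbit-code (toℕ i)) (orbit-code (toℕ j)) same-index)))
    where
      orbit : ℕ → A
      orbit zero    = x
      orbit (suc k) = f (orbit k)

      orbit∈S : ∀ k → S (orbit k)
      orbit∈S zero    = x∈S
      orbit∈S (suc k) = f-preserves-S (orbit∈S k)

      orbit-code : ∀ k → code (orbit k) ∈ xs
      orbit-code k = S⇒code∈xs (orbit∈S k)

      orbit-injective : ∀ i j → orbit i ≡ orbit j → i ≡ j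
      orbit-injective zero    zero    _  = refl
      orbit-injective zero    (suc j) eq = ⊥-elim (x-missed (orbit j) (sym eq))
      orbit-injective (suc i) zero    eq = ⊥-elim (x-missed (orbit i) eq)
      orbit-injective (suc i) (suc j) eq = cong suc (orbit-injective i j (f-injective eq))

module UnfoldingTree (G : FinGraph) (R : Vtx G) where
  open FinGraph G

  isPath-irrelevant : ∀ {v} p (h h' : IsPathFrom G v p) → h ≡ h'
  isPath-irrelevant []      tt       tt         = refl
  isPath-irrelevant (e ∷ p) (oe , h) (oe' , h') =
    cong₂ _,_ (Decidable⇒UIP.≡-irrelevant _≟ᶠ_ oe oe') (isPath-irrelevant p h h')

  ++-isPath : ∀ {v} p q → IsPathFrom G v p → IsPathFrom G (terminus G v p) q →
              IsPathFrom G v (p ++ q)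
  ++-isPath []      q _        hq = hq
  ++-isPath (e ∷ p) q (oe , hp) hq = oe , ++-isPath p q hp hq

  ++-isPathˡ : ∀ {v} p q → IsPathFrom G v (p ++ q) → IsPathFrom G v p
  ++-isPathˡ []      q _        = tt
  ++-isPathˡ (e ∷ p) q (oe , h) = oe , ++-isPathˡ p q h

  ++-isPathʳ : ∀ {v} p q → IsPathFrom G v (p ++ q) → IsPathFrom G (terminus G v p) q
  ++-isPathʳ []      q h       = h
  ++-isPathʳ (e ∷ p) q (_ , h) = ++-isPathʳ p q h

  terminus-++ : ∀ v p q → terminus G v (p ++ q) ≡ terminus G (terminus G v p) q
  terminus-++ v []      q = refl
  terminus-++ v (e ∷ p) q = terminus-++ (t e) p q

  isPrefix-++ : ∀ p q → isPrefix G p (p ++ q) ≡ true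
  isPrefix-++ []      q = refl
  isPrefix-++ (e ∷ p) q rewrite dec-true (e ≟ᶠ e) refl = isPrefix-++ p q

  isPrefix-++-cancelˡ : ∀ p q r → isPrefix G (p ++ q) (p ++ r) ≡ isPrefix G q r
  isPrefix-++-cancelˡ []      q r = refl
  isPrefix-++-cancelˡ (e ∷ p) q r rewrite dec-true (e ≟ᶠ e) refl = isPrefix-++-cancelˡ p q r

  isPrefix⇒++ : ∀ p q → isPrefix G p q ≡ true → ∃[ r ] q ≡ p ++ r
  isPrefix⇒++ []      q       _ = q , refl
  isPrefix⇒++ (e ∷ p) []      ()
  isPrefix⇒++ (e ∷ p) (f ∷ q) h with e ≟ᶠ f
  isPrefix⇒++ (e ∷ p) (f ∷ q) h  | yes refl = map₂ (cong (e ∷_)) (isPrefix⇒++ p q h)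
  isPrefix⇒++ (e ∷ p) (f ∷ q) () | no _

  isPrefix-refl : ∀ p → isPrefix G p p ≡ true
  isPrefix-refl p = subst (λ q → isPrefix G p q ≡ true) (++-identityʳ p) (isPrefix-++ p [])

  UV : Set
  UV = UVertex G R

  UE : Set
  UE = UEdge G R

  ≡-UVertex : ∀ {p q hp hq} → p ≡ q → _≡_ {A = UV} (p , hp) (q , hq)
  ≡-UVertex {p} {hp = hp} {hq} refl = cong (p ,_) (isPath-irrelevant p hp hq)

  infix 25 𝒯^_

  𝒯^_ : UV → DiGraph
  𝒯^_ = UnfoldingAt G R

  depth : UV → ℕ
  depth w = length (proj₁ w)

  length-∷ʳ : ∀ (p : List (Edg G)) e → length (p ++ [ e ]) ≡ suc (length p)
  length-∷ʳ p e = trans (length-++ p) (+-comm (length p) 1)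

  depth-tgt≤1+depth-src : ∀ Q ε → depth (tgt (𝒯^ Q) ε) ≤ suc (depth (src (𝒯^ Q) ε))
  depth-tgt≤1+depth-src Q ((p , _) , e , _) with isPrefix G (p ++ [ e ]) (proj₁ Q)
  ... | true  = m≤n⇒m≤1+n (≤-trans (n≤1+n (length p)) (≤-reflexive (sym (length-∷ʳ p e))))
  ... | false = ≤-reflexive (length-∷ʳ p e)

  walk-length-bound : ∀ {Q u w k} → Walk (𝒯^ Q) u w k → depth w ≤ depth u + k
  walk-length-bound {u = u} stop = ≤-reflexive (sym (+-identityʳ (depth u)))
  walk-length-bound {Q} {u} {k = suc k} (step walk ε refl refl) =
    ≤-trans (depth-tgt≤1+depth-src Q ε)
      (≤-trans (s≤s (walk-length-bound {Q} walk)) (≤-reflexive (sym (+-suc (depth u) k))))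

  walk-to-prefix : ∀ Q a b (ha : IsPathFrom G R a) → a ++ b ≡ proj₁ Q →
                   Walk (𝒯^ Q) Q (a , ha) (length b)
  walk-to-prefix Q a []      ha a≡Q = subst (λ w → Walk (𝒯^ Q) Q w 0)
    (≡-UVertex (trans (sym a≡Q) (++-identityʳ a))) stop
  walk-to-prefix Q a (f ∷ b) ha afb≡Q =
    step (walk-to-prefix Q (a ++ [ f ]) b haf af++b≡Q) ((a , ha) , f , of)
      (trans (if-true onPath) (≡-UVertex refl)) (if-true onPath)
    where
      af++b≡Q : (a ++ [ f ]) ++ b ≡ proj₁ Q
      af++b≡Q = trans (++-assoc a [ f ] b) afb≡Q
      haf : IsPathFrom G R (a ++ [ f ])
      haf = ++-isPathˡ (a ++ [ f ]) b (subst (IsPathFrom G R) (sym af++b≡Q) (proj₂ Q))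
      of : o f ≡ terminus G R a
      of = proj₁ (++-isPathʳ a (f ∷ b) (subst (IsPathFrom G R) (sym afb≡Q) (proj₂ Q)))
      onPath : isPrefix G (a ++ [ f ]) (proj₁ Q) ≡ true
      onPath = subst (λ q → isPrefix G (a ++ [ f ]) q ≡ true) af++b≡Q (isPrefix-++ (a ++ [ f ]) b)

  walk-to-root : ∀ Q → Walk (𝒯^ Q) Q (uRoot G R) (depth Q)
  walk-to-root Q = walk-to-prefix Q [] (proj₁ Q) tt refl

  isSource-𝒯^ : ∀ Q → IsSource (𝒯^ Q) Q
  isSource-𝒯^ Q ((p , _) , e , _) tgt≡Q with isPrefix G (p ++ [ e ]) (proj₁ Q) in onPath
  ... | true  = let r , Q≡per = isPrefix⇒++ (p ++ [ e ]) (proj₁ Q) onPath in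
    contradiction (++-identityʳ-unique p (trans (cong proj₁ tgt≡Q) (trans Q≡per (++-assoc p [ e ] r)))) λ ()
  ... | false = contradiction
    (trans (sym (isPrefix-refl (p ++ [ e ])))
           (subst (λ q → isPrefix G (p ++ [ e ]) q ≡ false) (sym (cong proj₁ tgt≡Q)) onPath)) λ ()

  has-incoming : ∀ Q w → proj₁ w ≢ proj₁ Q → ∃[ ε ] tgt (𝒯^ Q) ε ≡ w
  has-incoming Q (w , hw) w≢Q with isPrefix G w (proj₁ Q) in w-onPath
  ... | true with isPrefix⇒++ w (proj₁ Q) w-onPath
  ...   | []    , Q≡w   = contradiction (sym (trans Q≡w (++-identityʳ w))) w≢Q
  ...   | f ∷ r , Q≡wfr = ((w , hw) , f , of) , if-true onPath
    where
      of : o f ≡ terminus G R w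
      of = proj₁ (++-isPathʳ w (f ∷ r) (subst (IsPathFrom G R) Q≡wfr (proj₂ Q)))
      onPath : isPrefix G (w ++ [ f ]) (proj₁ Q) ≡ true
      onPath = subst (λ q → isPrefix G (w ++ [ f ]) q ≡ true)
        (sym (trans Q≡wfr (sym (++-assoc w [ f ] r)))) (isPrefix-++ (w ++ [ f ]) r)
  has-incoming Q (w , hw) w≢Q | false with initLast w
  ... | []      = contradiction w-onPath λ ()
  ... | p ∷ʳ′ e = ((p , ++-isPathˡ p [ e ] hw) , e , proj₁ (++-isPathʳ p [ e ] hw)) ,
                  trans (if-false w-onPath) (≡-UVertex refl)

  isSource⇒≡ : ∀ Q w → IsSource (𝒯^ Q) w → w ≡ Q
  isSource⇒≡ Q w w-source with ≡-dec _≟ᶠ_ (proj₁ w) (proj₁ Q)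
  ... | yes w≡Q = ≡-UVertex w≡Q
  ... | no  w≢Q = let ε , tgt≡w = has-incoming Q w w≢Q in contradiction tgt≡w (w-source ε)

  ≇-by-embedding-missing-root :
    ∀ {Q Q'} (h : Hom (𝒯^ Q) (𝒯^ Q')) → Hom.onV h Q ≡ Q' → Injective _≡_ _≡_ (Hom.onV h) →
    (∀ w → Hom.onV h w ≢ uRoot G R) → ¬ (𝒯^ Q ≅ 𝒯^ Q')
  ≇-by-embedding-missing-root {Q} {Q'} h hQ≡Q' h-injective root-missed φ =
    injective-endo-misses-nothing (Hom.onV ψ) (h-injective ∘ from-injective φ)
      (λ w → Walk (𝒯^ Q) Q w (depth Q')) ψ-preserves-ball
      proj₁ ≡-UVertex (shortLists m (depth Q + depth Q'))
      (λ walk → ∈-shortLists _ (walk-length-bound {Q} walk))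
      root-preimage-in-ball (λ y → root-missed y ∘ from-injective φ)
    where
      fromV = Inverse.from (_≅_.φV φ)
      ψ = from-hom φ ∘ᴴ h

      fromV-Q'≡Q : fromV Q' ≡ Q
      fromV-Q'≡Q = isSource⇒≡ Q (fromV Q') (from-isSource φ (isSource-𝒯^ Q'))

      ψ-preserves-ball : ∀ {w} → Walk (𝒯^ Q) Q w (depth Q') → Walk (𝒯^ Q) Q (Hom.onV ψ w) (depth Q')
      ψ-preserves-ball walk = subst (λ u → Walk (𝒯^ Q) u _ (depth Q'))
        (trans (cong fromV hQ≡Q') fromV-Q'≡Q) (map-walk ψ walk)

      root-preimage-in-ball : Walk (𝒯^ Q) Q (fromV (uRoot G R)) (depth Q')
      root-preimage-in-ball = subst (λ u → Walk (𝒯^ Q) u _ (depth Q')) fromV-Q'≡Q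
        (map-walk (from-hom φ) (walk-to-root Q'))

  IsClosed : List (Edg G) → Set
  IsClosed p = IsPathFrom G R p × terminus G R p ≡ R

  from-closed : ∀ {p} → IsClosed p → ∀ q → IsPathFrom G R q → IsPathFrom G (terminus G R p) q
  from-closed (_ , p-closed) q = subst (λ v → IsPathFrom G v q) (sym p-closed)

  ++-isClosed : ∀ {p q} → IsClosed p → IsClosed q → IsClosed (p ++ q)
  ++-isClosed {p} {q} p-closed (hq , q-closed) =
    ++-isPath p q (proj₁ p-closed) (from-closed p-closed q hq) ,
    trans (terminus-++ R p q) (trans (cong (λ v → terminus G v q) (proj₂ p-closed)) q-closed)

  _^_ : List (Edg G) → ℕ → List (Edg G)
  c ^ zero  = []
  c ^ suc k = c ++ c ^ k

  ^-isClosed : ∀ {c} → IsClosed c → ∀ k → IsClosed (c ^ k)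
  ^-isClosed c-closed zero    = tt , refl
  ^-isClosed c-closed (suc k) = ++-isClosed c-closed (^-isClosed c-closed k)

  ^-+ : ∀ c i j → c ^ (i + j) ≡ c ^ i ++ c ^ j
  ^-+ c zero    j = refl
  ^-+ c (suc i) j = trans (cong (c ++_) (^-+ c i j)) (sym (++-assoc c (c ^ i) (c ^ j)))

  module Prefix (P : List (Edg G)) (P-closed : IsClosed P) where
    prefixV : UV → UV
    prefixV (q , hq) = P ++ q , ++-isPath P q (proj₁ P-closed) (from-closed P-closed q hq)

    prefixE : UE → UE
    prefixE ((q , hq) , e , oe) = prefixV (q , hq) , e ,
      trans oe (trans (cong (λ v → terminus G v q) (sym (proj₂ P-closed))) (sym (terminus-++ R P q)))

    onPath-prefix : ∀ Q q e → isPrefix G ((P ++ q) ++ [ e ]) (P ++ Q) ≡ isPrefix G (q ++ [ e ]) Q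
    onPath-prefix Q q e = trans (cong (λ p → isPrefix G p (P ++ Q)) (++-assoc P q [ e ]))
                                (isPrefix-++-cancelˡ P (q ++ [ e ]) Q)

    prefix-hom : ∀ Q → Hom (𝒯^ Q) (𝒯^ prefixV Q)
    prefix-hom (Q , hQ) = record
      { onV = prefixV ; onE = prefixE ; src-comm = prefix-src ; tgt-comm = prefix-tgt }
      where
        prefix-src : ∀ ε → src (𝒯^ prefixV (Q , hQ)) (prefixE ε) ≡ prefixV (src (𝒯^ (Q , hQ)) ε)
        prefix-src ((q , hq) , e , _) rewrite onPath-prefix Q q e with isPrefix G (q ++ [ e ]) Q
        ... | true  = ≡-UVertex (++-assoc P q [ e ])
        ... | false = refl

        prefix-tgt : ∀ ε → tgt (𝒯^ prefixV (Q , hQ)) (prefixE ε) ≡ prefixV (tgt (𝒯^ (Q , hQ)) ε)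
        prefix-tgt ((q , hq) , e , _) rewrite onPath-prefix Q q e with isPrefix G (q ++ [ e ]) Q
        ... | true  = refl
        ... | false = ≡-UVertex (++-assoc P q [ e ])

    prefixV-injective : Injective _≡_ _≡_ prefixV
    prefixV-injective eq = ≡-UVertex (++-cancelˡ P _ _ (cong proj₁ eq))

    𝒯^≇𝒯^prefix : P ≢ [] → ∀ Q → ¬ (𝒯^ Q ≅ 𝒯^ prefixV Q)
    𝒯^≇𝒯^prefix P≢[] Q = ≇-by-embedding-missing-root {Q} (prefix-hom Q) refl prefixV-injective
      (λ w eq → P≢[] (++-conicalˡ P (proj₁ w) (cong proj₁ eq)))

lemma20 : (G : FinGraph) (R : Vtx G) → IsRooted G R → NoSinks G →
    IsCocompactUnfolding G R → ∀ (e : Edg G) → ¬ (FinGraph.t G e ≡ R)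
lemma20 G R rooted _ (k , label , cocompact) e te≡R =
  let i , j , i<j , same-label = pigeonhole (n<1+n k) (label ∘ cycleVertex ∘ toℕ)
      d = toℕ j ∸ suc (toℕ i)
      open Prefix (c ^ suc d) (^-isClosed c-closed (suc d))
      prefix-cⁱ≡cʲ : prefixV (cycleVertex (toℕ i)) ≡ cycleVertex (toℕ j)
      prefix-cⁱ≡cʲ = ≡-UVertex (trans (sym (^-+ c (suc d) (toℕ i)))
                                      (cong (c ^_) (trans (sym (+-suc d (toℕ i))) (m∸n+n≡m i<j))))
  in 𝒯^≇𝒯^prefix (c^suc≢[] d) (cycleVertex (toℕ i))
       (subst (λ w → 𝒯^ cycleVertex (toℕ i) ≅ 𝒯^ w) (sym prefix-cⁱ≡cʲ) (cocompact _ _ same-label))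
  where
    open FinGraph G
    open UnfoldingTree G R

    q : List (Edg G)
    q = proj₁ (rooted (o e))

    c : List (Edg G)
    c = q ++ [ e ]

    c-closed : IsClosed c
    c-closed = let _ , hq , tq = rooted (o e) in
      snoc-path G R q e hq (sym tq) , trans (terminus-++ R q [ e ]) te≡R

    c^suc≢[] : ∀ n → c ^ suc n ≢ []
    c^suc≢[] n eq = contradiction (++-conicalʳ q [ e ] (++-conicalˡ c (c ^ n) eq)) λ ()

    cycleVertex : ℕ → UVertex G R
    cycleVertex k = c ^ k , proj₁ (^-isClosed c-closed k)
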